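{- Let $y\in\mathbb{R}^{\binom{n}{2}}$ be a facet normal of $\tau_n$ and let $G$ be the simple graph on vertex set $[n]$ whose edges are the pairs $e$ with $y(e) \le 0$. If $G$ is bipartite, then $G$ is complete bipartite.
   Context: Vectors in $\mathbb{R}^{\binom{n}{2}}$ are indexed by the $2$-subsets (edges) of $[n]$; $y(e)$ is the entry at $e$. For a $3$-subset $K$, $\mathds{1}_K$ denotes the vector equal to $1$ on the three $2$-subsets of $K$ and $0$ elsewhere (a triangle). $\tau_n$ is the cone generated by all triangles. A vector $y$ is a facet normal of $\tau_n$ if (1) $\langle y, \mathds{1}_K\rangle \ge 0$ for all triangles $K$, and (2) the linear span of the triangles $\mathds{1}_K$ with $\langle y, \mathds{1}_K\rangle=0$ has codimension $1$.
   Formalization: The facet normal y has rational entries, and the span of the tight triangles and its codimension are taken over ℚ rather than ℝ. -}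

module Defs where

open import Data.Nat as ℕ using (ℕ; zero; suc)
open import Data.Nat.Combinatorics using (_C_)
open import Data.Fin using (Fin; _<_)
open import Data.Fin.Properties using (_≟_)
open import Data.Rational using (ℚ; 0ℚ; 1ℚ; _+_; _*_; _≤_)
open import Data.Product using (Σ; ∃; _×_; _,_; proj₁; proj₂)
open import Data.Bool using (Bool; if_then_else_)
open import Relation.Nullary using (¬_)
open import Relation.Nullary.Decidable using (⌊_⌋; _×-dec_; _⊎-dec_)
open import Relation.Binary.PropositionalEquality using (_≡_; _≢_)
open import Function.Bundles using (_⇔_)

-- 2-subsets {i , j} of [n], represented as ordered pairs i < j
Edge : ℕ → Set
Edge n = Σ (Fin n × Fin n) λ p → proj₁ p < proj₂ p

-- 3-subsets {i , j , k} of [n], represented with i < j < k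
Triple : ℕ → Set
Triple n = Σ (Fin n × Fin n × Fin n) λ t → (proj₁ t < proj₁ (proj₂ t)) × (proj₁ (proj₂ t) < proj₂ (proj₂ t))

EVec : ℕ → Set
EVec n = Edge n → ℚ

-- the triangle vector 𝟙_K : 1 on the three 2-subsets of K, 0 elsewhere
𝟙 : {n : ℕ} → Triple n → EVec n
𝟙 ((i , j , k) , _) ((a , b) , _) =
  if ⌊ ((a ≟ i) ×-dec (b ≟ j)) ⊎-dec (((a ≟ i) ×-dec (b ≟ k)) ⊎-dec ((a ≟ j) ×-dec (b ≟ k))) ⌋
  then 1ℚ else 0ℚ

-- ⟨ y , 𝟙_K ⟩ = y(ij) + y(ik) + y(jk)
pairT : {n : ℕ} → EVec n → Triple n → ℚ
pairT y ((i , j , k) , (p , q)) =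
  y ((i , j) , p) + y ((i , k) , Data.Fin.Properties.<-trans p q) + y ((j , k) , q)

sumFin : (m : ℕ) → (Fin m → ℚ) → ℚ
sumFin zero f = 0ℚ
sumFin (suc m) f = f Data.Fin.zero + sumFin m (λ k → f (Data.Fin.suc k))


lincomb : {n m : ℕ} → (Fin m → ℚ) → (Fin m → EVec n) → EVec n
lincomb {m = m} c v e = sumFin m (λ k → c k * v k e)

LinIndep : {n m : ℕ} → (Fin m → EVec n) → Set
LinIndep v = ∀ c → (∀ e → lincomb c v e ≡ 0ℚ) → ∀ k → c k ≡ 0ℚ

InSpanTri : {n : ℕ} → (Triple n → Set) → EVec n → Set
InSpanTri {n} S w =
  Σ ℕ λ m → Σ (Fin m → Triple n) λ K → (∀ k → S (K k)) ×
    Σ (Fin m → ℚ) λ c → ∀ e → w e ≡ lincomb c (λ k → 𝟙 (K k)) e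

HasDim : {n : ℕ} → (EVec n → Set) → ℕ → Set
HasDim {n} P d =
  (Σ (Fin d → EVec n) λ v → (∀ k → P (v k)) × LinIndep v) ×
  ¬ (Σ (Fin (suc d) → EVec n) λ v → (∀ k → P (v k)) × LinIndep v)

Tight : {n : ℕ} → EVec n → Triple n → Set
Tight y K = pairT y K ≡ 0ℚ

-- facet normal of τ_n: nonnegative on all triangles, and the span of
-- the tight triangles has codimension 1 in ℚ^(n choose 2)
IsFacetNormal : (n : ℕ) → EVec n → Set
IsFacetNormal n y =
  (∀ K → 0ℚ ≤ pairT y K) ×
  (Σ ℕ λ d → HasDim (InSpanTri (Tight y)) d × suc d ≡ n C 2)

GEdge : {n : ℕ} → EVec n → Edge n → Set
GEdge y e = y e ≤ 0ℚ

IsBipartite : {n : ℕ} → (Edge n → Set) → Set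
IsBipartite {n} E = Σ (Fin n → Bool) λ col →
  ∀ (e : Edge n) → E e → col (proj₁ (proj₁ e)) ≢ col (proj₂ (proj₁ e))

IsCompleteBipartite : {n : ℕ} → (Edge n → Set) → Set
IsCompleteBipartite {n} E = Σ (Fin n → Bool) λ col →
  ∀ (e : Edge n) → E e ⇔ (col (proj₁ (proj₁ e)) ≢ col (proj₂ (proj₁ e)))

{-# OPTIONS --safe #-}
-- Let z be 2 on the pairs inside a colour class of the bipartition and -1 on the pairs across it.
-- A triangle inside a colour class is never tight, since y is positive on its three edges, and
-- every other triangle has z-sum 2 - 1 - 1 = 0. So y and z are both orthogonal to the span of the
-- tight triangles, which has codimension 1, and hence are proportional. For n ≥ 3 some pair lies
-- inside a colour class and y is positive on it, so y is a positive multiple of z and y ≤ 0 on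
-- every pair across the bipartition. For n ≤ 2 there is at most one pair.
module Submission where

open import Defs
open import Algebra.Bundles using (CommutativeRing)
open import Data.Bool using (Bool; true; false; if_then_else_; _xor_)
open import Data.Empty using (⊥-elim)
open import Data.Fin as F using (Fin; zero; suc; punchIn)
import Data.Fin.Properties as FP
open import Data.List as List using (List; length; map; _++_; allFin)
import Data.List.Properties as LP
open import Data.List.Membership.Propositional using (_∈_)
open import Data.List.Membership.Propositional.Properties using (∈-map⁺; ∈-++⁺ˡ; ∈-++⁺ʳ; ∈-allFin)
open import Data.List.Relation.Unary.Any using (here; there)
open import Data.Nat as ℕ using (ℕ; z≤n; s≤s)
import Data.Nat.Properties as NP
open import Data.Nat.Combinatorics using (_C_; nC1≡n; nCk+nC[k+1]≡[n+1]C[k+1])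
open import Data.Product using (Σ; ∃; _×_; _,_; proj₁; proj₂)
open import Data.Rational as Q using (ℚ; 0ℚ; 1ℚ; _+_; _*_; -_; _-_; _≤_; _<_; 1/_)
import Data.Rational.Properties as QP
open import Data.Rational.Solver using (module +-*-Solver)
open import Data.Sum using (inj₁; inj₂)
open import Data.Vec.Functional using (insertAt; removeAt; []; _∷_)
open import Data.Vec.Functional.Properties using (insertAt-lookup; insertAt-punchIn)
open import Function using (_∘_; mk⇔)
open import Relation.Nullary using (¬_; Dec; yes; no)
open import Relation.Nullary.Decidable using (⌊_⌋; _×-dec_; _⊎-dec_)
open import Relation.Binary.PropositionalEquality
open import Relation.Binary.Definitions using (tri<; tri≈; tri>)

open import Algebra.Properties.Semiring.Sum (CommutativeRing.semiring QP.+-*-commutativeRing)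
open +-*-Solver

sumFin≡sum : ∀ m (f : Fin m → ℚ) → sumFin m f ≡ sum f
sumFin≡sum ℕ.zero f = refl
sumFin≡sum (ℕ.suc m) f = cong (f zero +_) (sumFin≡sum m (f ∘ suc))

sum-zero : ∀ {m} {f : Fin m → ℚ} → (∀ i → f i ≡ 0ℚ) → sum f ≡ 0ℚ
sum-zero {m} f≗0 = trans (sum-cong-≗ f≗0) (sum-replicate-zero m)

sum-select : ∀ {m} (f : Fin m → ℚ) (p : Fin m) → (∀ i → i ≢ p → f i ≡ 0ℚ) → sum f ≡ f p
sum-select {ℕ.suc m} f p f≗0 = begin
  sum f                        ≡⟨ sum-remove f ⟩
  f p + sum (removeAt f p)     ≡⟨ cong (f p +_) (sum-zero (λ k → f≗0 (punchIn p k) (FP.punchInᵢ≢i p k))) ⟩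
  f p + 0ℚ                     ≡⟨ QP.+-identityʳ (f p) ⟩
  f p                          ∎
  where open ≡-Reasoning

sum-*-zero : ∀ {m} (c : Fin m → ℚ) {g : Fin m → ℚ} → (∀ k → g k ≡ 0ℚ) → ∑[ k < m ] (c k * g k) ≡ 0ℚ
sum-*-zero c g≗0 = sum-zero λ k → trans (cong (c k *_) (g≗0 k)) (QP.*-zeroʳ (c k))

p≤p+q : ∀ p {q} → 0ℚ ≤ q → p ≤ p + q
p≤p+q p {q} 0≤q = subst (_≤ p + q) (QP.+-identityʳ p) (QP.+-monoʳ-≤ p 0≤q)

sum-nonNeg : ∀ {m} (f : Fin m → ℚ) → (∀ i → 0ℚ ≤ f i) → 0ℚ ≤ sum f
sum-nonNeg {ℕ.zero} f f≥0 = QP.≤-refl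
sum-nonNeg {ℕ.suc m} f f≥0 = QP.+-mono-≤ (f≥0 zero) (sum-nonNeg (f ∘ suc) (f≥0 ∘ suc))

≤-sum : ∀ {m} (f : Fin m → ℚ) → (∀ i → 0ℚ ≤ f i) → ∀ p → f p ≤ sum f
≤-sum {ℕ.suc m} f f≥0 p = subst (f p ≤_) (sym (sum-remove f))
  (p≤p+q (f p) (sum-nonNeg (removeAt f p) (f≥0 ∘ punchIn p)))

p*q≡0⇒p≡0 : ∀ p {q} → q ≢ 0ℚ → p * q ≡ 0ℚ → p ≡ 0ℚ
p*q≡0⇒p≡0 p {q} q≢0 pq≡0 = begin
  p                  ≡⟨ sym (QP.*-identityʳ p) ⟩
  p * 1ℚ             ≡⟨ cong (p *_) (sym (QP.*-inverseʳ q)) ⟩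
  p * (q * 1/ q)     ≡⟨ sym (QP.*-assoc p q (1/ q)) ⟩
  p * q * 1/ q       ≡⟨ cong (_* 1/ q) pq≡0 ⟩
  0ℚ * 1/ q          ≡⟨ QP.*-zeroˡ (1/ q) ⟩
  0ℚ                 ∎
  where
  open ≡-Reasoning
  instance _ = Q.≢-nonZero q≢0

p*q≢0 : ∀ {p q} → p ≢ 0ℚ → q ≢ 0ℚ → p * q ≢ 0ℚ
p*q≢0 p≢0 q≢0 pq≡0 = p≢0 (p*q≡0⇒p≡0 _ q≢0 pq≡0)

square-nonNeg : ∀ p → 0ℚ ≤ p * p
square-nonNeg p with QP.≤-total 0ℚ p
... | inj₁ 0≤p = QP.nonNegative⁻¹ _ {{QP.nonNeg*nonNeg⇒nonNeg p {{Q.nonNegative 0≤p}} p {{Q.nonNegative 0≤p}}}}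
... | inj₂ p≤0 = QP.nonNegative⁻¹ _ {{QP.nonPos*nonPos⇒nonPos p {{Q.nonPositive p≤0}} p {{Q.nonPositive p≤0}}}}

square-pos : ∀ {p} → p ≢ 0ℚ → 0ℚ < p * p
square-pos {p} p≢0 with QP.<-cmp p 0ℚ
... | tri< p<0 _ _ = QP.positive⁻¹ _ {{QP.neg*neg⇒pos p {{Q.negative p<0}} p {{Q.negative p<0}}}}
... | tri≈ _ p≡0 _ = ⊥-elim (p≢0 p≡0)
... | tri> _ _ p>0 = QP.positive⁻¹ _ {{QP.pos*pos⇒pos p {{Q.positive p>0}} p {{Q.positive p>0}}}}

*-pos : ∀ {p q} → 0ℚ < p → 0ℚ < q → 0ℚ < p * q
*-pos {p} {q} p>0 q>0 = QP.positive⁻¹ _ {{QP.pos*pos⇒pos p {{Q.positive p>0}} q {{Q.positive q>0}}}}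

module _ {X : Set} where

  LinearlyDependentOn : List X → ∀ {m} → (Fin m → X → ℚ) → Set
  LinearlyDependentOn L {m} v = Σ (Fin m → ℚ) λ c →
    (∀ x → x ∈ L → ∑[ k < m ] (c k * v k x) ≡ 0ℚ) × ∃ λ k → c k ≢ 0ℚ

  -- One step of Gaussian elimination on the coordinate x with pivot v p x: the m vectors
  -- eliminatePivot k vanish at x, and a dependency among them lifts to one among the v k.
  module _ {m} (v : Fin (ℕ.suc m) → X → ℚ) (p : Fin (ℕ.suc m)) (x : X) where

    eliminatePivot : Fin m → X → ℚ
    eliminatePivot k y = v p x * v (punchIn p k) y - v (punchIn p k) x * v p y

    eliminatePivot-vanishes : ∀ k → eliminatePivot k x ≡ 0ℚ
    eliminatePivot-vanishes k = solve 2 (λ a b → a :* b :- b :* a := con 0ℚ) refl (v p x) (v (punchIn p k) x)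

    liftPivot : (Fin m → ℚ) → Fin (ℕ.suc m) → ℚ
    liftPivot c = insertAt (λ k → c k * v p x) p (- ∑[ k < m ] (c k * v (punchIn p k) x))

    liftPivot-combination : ∀ c y →
      ∑[ k < ℕ.suc m ] (liftPivot c k * v k y) ≡ ∑[ k < m ] (c k * eliminatePivot k y)
    liftPivot-combination c y = begin
      ∑[ k < ℕ.suc m ] (c′ k * v k y)
        ≡⟨ sum-remove (λ k → c′ k * v k y) ⟩
      c′ p * v p y + ∑[ k < m ] (c′ (punchIn p k) * v (punchIn p k) y)
        ≡⟨ cong₂ _+_ (cong (_* v p y) (insertAt-lookup _ p _))
                     (sum-cong-≗ λ k → cong (_* v (punchIn p k) y) (insertAt-punchIn _ p _ k)) ⟩
      - S * v p y + ∑[ k < m ] (c k * v p x * v (punchIn p k) y)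
        ≡⟨ cong (_+ ∑[ k < m ] (c k * v p x * v (punchIn p k) y))
             (trans (solve 2 (λ s t → (:- s) :* t := (:- t) :* s) refl S (v p y))
                    (*-distribˡ-sum (- v p y) (λ k → c k * v (punchIn p k) x))) ⟩
      ∑[ k < m ] (- v p y * (c k * v (punchIn p k) x)) + ∑[ k < m ] (c k * v p x * v (punchIn p k) y)
        ≡⟨ sym (∑-distrib-+ (λ k → - v p y * (c k * v (punchIn p k) x))
                            (λ k → c k * v p x * v (punchIn p k) y)) ⟩
      ∑[ k < m ] (- v p y * (c k * v (punchIn p k) x) + c k * v p x * v (punchIn p k) y)
        ≡⟨ sum-cong-≗ (λ k → solve 5 (λ t ck px a py →
                                         (:- t) :* (ck :* px) :+ ck :* a :* py := ck :* (a :* py :- px :* t))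
                                     refl (v p y) (c k) (v (punchIn p k) x) (v p x) (v (punchIn p k) y)) ⟩
      ∑[ k < m ] (c k * eliminatePivot k y) ∎
      where
      open ≡-Reasoning
      c′ = liftPivot c
      S = ∑[ k < m ] (c k * v (punchIn p k) x)

  length<⇒dependent : ∀ (L : List X) {m} → length L ℕ.< m → (v : Fin m → X → ℚ) → LinearlyDependentOn L v
  length<⇒dependent List.[] {ℕ.suc m} _ v = 1ℚ ∷ (λ _ → 0ℚ) , (λ _ ()) , zero , λ ()
  length<⇒dependent (x List.∷ L) {ℕ.suc m} (s≤s |L|<m) v with FP.all? (λ k → v k x QP.≟ 0ℚ)
  ... | yes v[x]≡0 =
    let c , c·v≡0 , k , ck≢0 = length<⇒dependent L (NP.m≤n⇒m≤1+n |L|<m) v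
        c·v[x]≡0 = sum-*-zero c v[x]≡0
    in c , (λ { _ (here refl) → c·v[x]≡0 ; y (there y∈L) → c·v≡0 y y∈L }) , k , ck≢0
  ... | no ¬v[x]≡0 =
    let p , vp[x]≢0 = FP.¬∀⟶∃¬ _ _ (λ k → v k x QP.≟ 0ℚ) ¬v[x]≡0
        c , c·w≡0 , k , ck≢0 = length<⇒dependent L |L|<m (eliminatePivot v p x)
        c·w[x]≡0 = sum-*-zero c (eliminatePivot-vanishes v p x)
    in liftPivot v p x c
     , (λ { _ (here refl) → trans (liftPivot-combination v p x c x) c·w[x]≡0
          ; y (there y∈L) → trans (liftPivot-combination v p x c y) (c·w≡0 y y∈L) })
     , punchIn p k
     , subst (_≢ 0ℚ) (sym (insertAt-punchIn _ p _ k)) (p*q≢0 ck≢0 vp[x]≢0)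

edge-irrelevant : ∀ {n} {i j : Fin n} (p q : i F.< j) → _≡_ {A = Edge n} ((i , j) , p) ((i , j) , q)
edge-irrelevant p q = cong ((_ , _) ,_) (FP.<-irrelevant p q)

allEdges : ∀ n → List (Edge n)
allEdges ℕ.zero = List.[]
allEdges (ℕ.suc n) = map fromZero (allFin n) ++ map lift (allEdges n)
  where
  fromZero : Fin n → Edge (ℕ.suc n)
  fromZero j = (zero , suc j) , s≤s z≤n
  lift : Edge n → Edge (ℕ.suc n)
  lift ((i , j) , i<j) = (suc i , suc j) , s≤s i<j

length-allEdges : ∀ n → length (allEdges n) ≡ n C 2
length-allEdges ℕ.zero = refl
length-allEdges (ℕ.suc n) = begin
  length (map _ (allFin n) ++ map _ (allEdges n))   ≡⟨ LP.length-++ (map _ (allFin n)) ⟩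
  length (map _ (allFin n)) ℕ.+ length (map _ (allEdges n))
    ≡⟨ cong₂ ℕ._+_ (trans (LP.length-map _ (allFin n)) (LP.length-tabulate {n = n} (λ i → i)))
                   (trans (LP.length-map _ (allEdges n)) (length-allEdges n)) ⟩
  n ℕ.+ n C 2                                        ≡⟨ cong (ℕ._+ n C 2) (sym (nC1≡n n)) ⟩
  n C 1 ℕ.+ n C 2                                    ≡⟨ nCk+nC[k+1]≡[n+1]C[k+1] n 1 ⟩
  ℕ.suc n C 2                                        ∎
  where open ≡-Reasoning

∈-allEdges : ∀ {n} (e : Edge n) → e ∈ allEdges n
∈-allEdges {ℕ.suc n} ((zero , suc j) , 0<j) =
  subst (_∈ allEdges (ℕ.suc n)) (edge-irrelevant _ 0<j) (∈-++⁺ˡ (∈-map⁺ _ (∈-allFin j)))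
∈-allEdges {ℕ.suc n} ((suc i , suc j) , s≤s i<j) =
  ∈-++⁺ʳ (map _ (allFin n)) (∈-map⁺ _ (∈-allEdges ((i , j) , i<j)))

lincomb≡∑ : ∀ {n m} (c : Fin m → ℚ) (v : Fin m → EVec n) e → lincomb c v e ≡ ∑[ k < m ] (c k * v k e)
lincomb≡∑ {m = m} c v e = sumFin≡sum m _

LinIndep⇒≤nC2 : ∀ {n m} (v : Fin m → EVec n) → LinIndep v → m ℕ.≤ n C 2
LinIndep⇒≤nC2 {n} {m} v indep with m NP.≤? n C 2
... | yes m≤nC2 = m≤nC2
... | no m≰nC2 =
  let |edges|<m = subst (ℕ._< m) (sym (length-allEdges n)) (NP.≰⇒> m≰nC2)
      c , c·v≡0 , k , ck≢0 = length<⇒dependent (allEdges n) |edges|<m v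
  in ⊥-elim (ck≢0 (indep c (λ e → trans (lincomb≡∑ c v e) (c·v≡0 e (∈-allEdges e))) k))

module _ {n : ℕ} where

  -- Zero outside the pairs i < j, so ⟨_,_⟩ below sums over edges.
  extend : EVec n → Fin n → Fin n → ℚ
  extend a i j with i FP.<? j
  ... | yes i<j = a ((i , j) , i<j)
  ... | no _ = 0ℚ

  extend-edge : (a : EVec n) {i j : Fin n} (i<j : i F.< j) → extend a i j ≡ a ((i , j) , i<j)
  extend-edge a {i} {j} i<j with i FP.<? j
  ... | yes i<j′ = cong a (edge-irrelevant i<j′ i<j)
  ... | no i≮j = ⊥-elim (i≮j i<j)

  extend-cong : {a b : EVec n} → (∀ e → a e ≡ b e) → ∀ i j → extend a i j ≡ extend b i j
  extend-cong a≗b i j with i FP.<? j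
  ... | yes _ = a≗b _
  ... | no _ = refl

  extend-lincomb : ∀ {m} (c : Fin m → ℚ) (v : Fin m → EVec n) i j →
    extend (lincomb c v) i j ≡ ∑[ k < m ] (c k * extend (v k) i j)
  extend-lincomb c v i j with i FP.<? j
  ... | yes _ = lincomb≡∑ c v _
  ... | no _ = sym (sum-*-zero c λ _ → refl)

  ⟨_,_⟩ : EVec n → EVec n → ℚ
  ⟨ a , b ⟩ = ∑[ i < n ] ∑[ j < n ] (extend a i j * extend b i j)

  ⟨⟩-comm : ∀ a b → ⟨ a , b ⟩ ≡ ⟨ b , a ⟩
  ⟨⟩-comm a b = sum-cong-≗ λ i → sum-cong-≗ λ j → QP.*-comm (extend a i j) (extend b i j)

  ⟨⟩-congʳ : ∀ a {b b′} → (∀ e → b e ≡ b′ e) → ⟨ a , b ⟩ ≡ ⟨ a , b′ ⟩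
  ⟨⟩-congʳ a b≗b′ = sum-cong-≗ λ i → sum-cong-≗ λ j → cong (extend a i j *_) (extend-cong b≗b′ i j)

  ⟨⟩-lincomb : ∀ {m} a (c : Fin m → ℚ) (v : Fin m → EVec n) →
    ⟨ a , lincomb c v ⟩ ≡ ∑[ k < m ] (c k * ⟨ a , v k ⟩)
  ⟨⟩-lincomb {m} a c v = begin
    ∑[ i < n ] ∑[ j < n ] (extend a i j * extend (lincomb c v) i j)
      ≡⟨ sum-cong-≗ (λ i → sum-cong-≗ λ j → trans (cong (extend a i j *_) (extend-lincomb c v i j))
                                                  (*-distribˡ-sum (extend a i j) (λ k → c k * extend (v k) i j))) ⟩
    ∑[ i < n ] ∑[ j < n ] ∑[ k < m ] (extend a i j * (c k * extend (v k) i j))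
      ≡⟨ sum-cong-≗ (λ i → ∑-comm (λ j k → extend a i j * (c k * extend (v k) i j))) ⟩
    ∑[ i < n ] ∑[ k < m ] ∑[ j < n ] (extend a i j * (c k * extend (v k) i j))
      ≡⟨ ∑-comm (λ i k → ∑[ j < n ] (extend a i j * (c k * extend (v k) i j))) ⟩
    ∑[ k < m ] ∑[ i < n ] ∑[ j < n ] (extend a i j * (c k * extend (v k) i j))
      ≡⟨ sum-cong-≗ (λ k → sum-cong-≗ λ i → sum-cong-≗ λ j → solve 3 (λ x y z → x :* (y :* z) := y :* (x :* z)) refl
                                                                (extend a i j) (c k) (extend (v k) i j)) ⟩
    ∑[ k < m ] ∑[ i < n ] ∑[ j < n ] (c k * (extend a i j * extend (v k) i j))
      ≡⟨ sum-cong-≗ (λ k → trans (sum-cong-≗ λ i → sym (*-distribˡ-sum (c k) λ j → extend a i j * extend (v k) i j))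
                                   (sym (*-distribˡ-sum (c k) λ i → ∑[ j < n ] (extend a i j * extend (v k) i j)))) ⟩
    ∑[ k < m ] (c k * ⟨ a , v k ⟩) ∎
    where open ≡-Reasoning

  ⟨⟩-zeroʳ : ∀ a {b} → (∀ e → b e ≡ 0ℚ) → ⟨ a , b ⟩ ≡ 0ℚ
  -- b is pointwise equal to the empty linear combination.
  ⟨⟩-zeroʳ a {b} b≗0 = trans (⟨⟩-congʳ a {b′ = lincomb {m = 0} [] []} b≗0) (⟨⟩-lincomb a [] [])

  ⟨⟩-pos : ∀ a e → a e ≢ 0ℚ → 0ℚ < ⟨ a , a ⟩
  ⟨⟩-pos a e@((i , j) , i<j) ae≢0 = begin-strict
    0ℚ                                     <⟨ square-pos ae≢0 ⟩
    a e * a e                              ≡⟨ sym (cong₂ _*_ (extend-edge a i<j) (extend-edge a i<j)) ⟩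
    extend a i j * extend a i j            ≤⟨ ≤-sum _ (λ j → square-nonNeg (extend a i j)) j ⟩
    ∑[ j < n ] (extend a i j * extend a i j) ≤⟨ ≤-sum _ (λ i → sum-nonNeg _ λ j → square-nonNeg (extend a i j)) i ⟩
    ⟨ a , a ⟩                              ∎
    where open QP.≤-Reasoning

indicator : ∀ {P : Set} → Dec P → ℚ
indicator P? = if ⌊ P? ⌋ then 1ℚ else 0ℚ

indicator-yes : ∀ {P : Set} (P? : Dec P) → P → indicator P? ≡ 1ℚ
indicator-yes (yes _) _ = refl
indicator-yes (no ¬p) p = ⊥-elim (¬p p)

indicator-no : ∀ {P : Set} (P? : Dec P) → ¬ P → indicator P? ≡ 0ℚ
indicator-no (yes p) ¬p = ⊥-elim (¬p p)
indicator-no (no _) _ = refl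

indicator-⊎₃ : ∀ {A B C : Set} (A? : Dec A) (B? : Dec B) (C? : Dec C) →
  (A → ¬ B) → (A → ¬ C) → (B → ¬ C) →
  indicator (A? ⊎-dec (B? ⊎-dec C?)) ≡ indicator A? + indicator B? + indicator C?
indicator-⊎₃ (yes a) (yes b) _       a#b a#c b#c = ⊥-elim (a#b a b)
indicator-⊎₃ (yes a) (no _)  (yes c) a#b a#c b#c = ⊥-elim (a#c a c)
indicator-⊎₃ (yes _) (no _)  (no _)  a#b a#c b#c = refl
indicator-⊎₃ (no _)  (yes b) (yes c) a#b a#c b#c = ⊥-elim (b#c b c)
indicator-⊎₃ (no _)  (yes _) (no _)  a#b a#c b#c = refl
indicator-⊎₃ (no _)  (no _)  (yes _) a#b a#c b#c = refl
indicator-⊎₃ (no _)  (no _)  (no _)  a#b a#c b#c = refl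

module _ {n : ℕ} where

  unit : Fin n → Fin n → EVec n
  unit i j ((x , y) , _) = indicator ((x FP.≟ i) ×-dec (y FP.≟ j))

  extend-unit-off : ∀ {i j x y} → ¬ (x ≡ i × y ≡ j) → extend (unit i j) x y ≡ 0ℚ
  extend-unit-off {i} {j} {x} {y} ≢ij with x FP.<? y
  ... | yes _ = indicator-no ((x FP.≟ i) ×-dec (y FP.≟ j)) ≢ij
  ... | no _ = refl

  ⟨,unit⟩ : ∀ a {i j} (i<j : i F.< j) → ⟨ a , unit i j ⟩ ≡ a ((i , j) , i<j)
  ⟨,unit⟩ a {i} {j} i<j = begin
    ⟨ a , unit i j ⟩
      ≡⟨ sum-select _ i (λ x x≢i → sum-*-zero (extend a x) λ y → extend-unit-off {x = x} {y} (x≢i ∘ proj₁)) ⟩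
    ∑[ y < n ] (extend a i y * extend (unit i j) i y)
      ≡⟨ sum-select _ j (λ y y≢j → trans (cong (extend a i y *_) (extend-unit-off {x = i} {y} (y≢j ∘ proj₂)))
                                         (QP.*-zeroʳ (extend a i y))) ⟩
    extend a i j * extend (unit i j) i j
      ≡⟨ cong₂ _*_ (extend-edge a i<j)
                   (trans (extend-edge (unit i j) i<j) (indicator-yes ((i FP.≟ i) ×-dec (j FP.≟ j)) (refl , refl))) ⟩
    a ((i , j) , i<j) * 1ℚ
      ≡⟨ QP.*-identityʳ _ ⟩
    a ((i , j) , i<j) ∎
    where open ≡-Reasoning

  sides : Triple n → Fin 3 → EVec n
  sides ((i , j , k) , _) = unit i j ∷ unit i k ∷ unit j k ∷ []

  𝟙≡sum-of-sides : ∀ K e → 𝟙 K e ≡ lincomb (λ _ → 1ℚ) (sides K) e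
  𝟙≡sum-of-sides ((i , j , k) , i<j , j<k) ((x , y) , x<y) = trans
    (indicator-⊎₃ ((x FP.≟ i) ×-dec (y FP.≟ j)) ((x FP.≟ i) ×-dec (y FP.≟ k)) ((x FP.≟ j) ×-dec (y FP.≟ k))
      (λ { (refl , refl) (_ , refl) → NP.<-irrefl refl j<k })
      (λ { (refl , _) (refl , _) → NP.<-irrefl refl i<j })
      (λ { (refl , _) (refl , _) → NP.<-irrefl refl i<j }))
    (solve 3 (λ a b c → a :+ b :+ c := con 1ℚ :* a :+ (con 1ℚ :* b :+ (con 1ℚ :* c :+ con 0ℚ))) refl
      (unit i j ((x , y) , x<y)) (unit i k ((x , y) , x<y)) (unit j k ((x , y) , x<y)))

  ⟨,𝟙⟩ : ∀ a K → ⟨ a , 𝟙 K ⟩ ≡ pairT a K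
  ⟨,𝟙⟩ a K@((i , j , k) , i<j , j<k) = begin
    ⟨ a , 𝟙 K ⟩                                      ≡⟨ ⟨⟩-congʳ a (𝟙≡sum-of-sides K) ⟩
    ⟨ a , lincomb (λ _ → 1ℚ) (sides K) ⟩             ≡⟨ ⟨⟩-lincomb a (λ _ → 1ℚ) (sides K) ⟩
    1ℚ * ⟨ a , unit i j ⟩ + (1ℚ * ⟨ a , unit i k ⟩ + (1ℚ * ⟨ a , unit j k ⟩ + 0ℚ))
      ≡⟨ cong₂ (λ s t → 1ℚ * s + (1ℚ * t + (1ℚ * ⟨ a , unit j k ⟩ + 0ℚ)))
               (⟨,unit⟩ a i<j) (⟨,unit⟩ a (FP.<-trans i<j j<k)) ⟩
    1ℚ * a ij + (1ℚ * a ik + (1ℚ * ⟨ a , unit j k ⟩ + 0ℚ))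
      ≡⟨ cong (λ t → 1ℚ * a ij + (1ℚ * a ik + (1ℚ * t + 0ℚ))) (⟨,unit⟩ a j<k) ⟩
    1ℚ * a ij + (1ℚ * a ik + (1ℚ * a jk + 0ℚ))
      ≡⟨ solve 3 (λ a b c → con 1ℚ :* a :+ (con 1ℚ :* b :+ (con 1ℚ :* c :+ con 0ℚ)) := a :+ b :+ c)
                 refl (a ij) (a ik) (a jk) ⟩
    pairT a K ∎
    where
    open ≡-Reasoning
    ij = (i , j) , i<j
    ik = (i , k) , FP.<-trans i<j j<k
    jk = (j , k) , j<k

module _ {n : ℕ} where

  Annihilates : EVec n → (Triple n → Set) → Set
  Annihilates a S = ∀ K → S K → pairT a K ≡ 0ℚ

  annihilates⇒⊥-span : ∀ {S a w} → Annihilates a S → InSpanTri S w → ⟨ a , w ⟩ ≡ 0ℚ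
  annihilates⇒⊥-span {a = a} {w} a⊥S (m , K , SK , c , w≗c·𝟙K) = begin
    ⟨ a , w ⟩                            ≡⟨ ⟨⟩-congʳ a w≗c·𝟙K ⟩
    ⟨ a , lincomb c (𝟙 ∘ K) ⟩            ≡⟨ ⟨⟩-lincomb a c (𝟙 ∘ K) ⟩
    ∑[ k < m ] (c k * ⟨ a , 𝟙 (K k) ⟩)   ≡⟨ sum-*-zero c (λ k → trans (⟨,𝟙⟩ a (K k)) (a⊥S (K k) (SK k))) ⟩
    0ℚ                                   ∎
    where open ≡-Reasoning

  LinIndep-∷ : ∀ {m} (w : EVec n) {v : Fin m → EVec n} e → w e ≢ 0ℚ →
    (∀ k → ⟨ w , v k ⟩ ≡ 0ℚ) → LinIndep v → LinIndep (w ∷ v)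
  LinIndep-∷ {m} w {v} e we≢0 w⊥v indep c c·wv≡0 = λ { zero → c₀≡0 ; (suc k) → indep (c ∘ suc) c·v≡0 k }
    where
    open ≡-Reasoning
    c₀≡0 : c zero ≡ 0ℚ
    c₀≡0 = p*q≡0⇒p≡0 (c zero) (≢-sym (QP.<⇒≢ (⟨⟩-pos w e we≢0))) (begin
      c zero * ⟨ w , w ⟩
        ≡⟨ sym (QP.+-identityʳ _) ⟩
      c zero * ⟨ w , w ⟩ + 0ℚ
        ≡⟨ cong (c zero * ⟨ w , w ⟩ +_) (sym (sum-*-zero (c ∘ suc) w⊥v)) ⟩
      c zero * ⟨ w , w ⟩ + ∑[ k < m ] (c (suc k) * ⟨ w , v k ⟩)
        ≡⟨ sym (⟨⟩-lincomb w c (w ∷ v)) ⟩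
      ⟨ w , lincomb c (w ∷ v) ⟩
        ≡⟨ ⟨⟩-zeroʳ w c·wv≡0 ⟩
      0ℚ ∎)
    c·v≡0 : ∀ e → lincomb (c ∘ suc) v e ≡ 0ℚ
    c·v≡0 e = begin
      lincomb (c ∘ suc) v e                  ≡⟨ sym (QP.+-identityˡ _) ⟩
      0ℚ + lincomb (c ∘ suc) v e             ≡⟨ cong (_+ lincomb (c ∘ suc) v e) c₀w[e]≡0 ⟨
      c zero * w e + lincomb (c ∘ suc) v e   ≡⟨ c·wv≡0 e ⟩
      0ℚ                                     ∎
      where c₀w[e]≡0 = trans (cong (_* w e) c₀≡0) (QP.*-zeroˡ (w e))

  ContainsIndependent : (EVec n → Set) → ℕ → Set
  ContainsIndependent P d = Σ (Fin d → EVec n) λ v → (∀ k → P (v k)) × LinIndep v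

  residual : EVec n → EVec n → EVec n
  residual a z = lincomb (⟨ z , z ⟩ ∷ - ⟨ z , a ⟩ ∷ []) (a ∷ z ∷ [])

  ⟨,residual⟩ : ∀ u a z → ⟨ u , residual a z ⟩ ≡ ⟨ z , z ⟩ * ⟨ u , a ⟩ - ⟨ z , a ⟩ * ⟨ u , z ⟩
  ⟨,residual⟩ u a z = trans (⟨⟩-lincomb u (⟨ z , z ⟩ ∷ - ⟨ z , a ⟩ ∷ []) (a ∷ z ∷ []))
    (solve 4 (λ Z P x y → Z :* x :+ ((:- P) :* y :+ con 0ℚ) := Z :* x :- P :* y) refl
      ⟨ z , z ⟩ ⟨ z , a ⟩ ⟨ u , a ⟩ ⟨ u , z ⟩)

  residual-⊥-z : ∀ a z → ⟨ residual a z , z ⟩ ≡ 0ℚ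
  residual-⊥-z a z = trans (⟨⟩-comm (residual a z) z) (trans (⟨,residual⟩ z a z)
    (solve 2 (λ Z P → Z :* P :- P :* Z := con 0ℚ) refl ⟨ z , z ⟩ ⟨ z , a ⟩))

  residual-⊥-common : ∀ {u} a z → ⟨ a , u ⟩ ≡ 0ℚ → ⟨ z , u ⟩ ≡ 0ℚ → ⟨ residual a z , u ⟩ ≡ 0ℚ
  residual-⊥-common {u} a z a⊥u z⊥u = begin
    ⟨ residual a z , u ⟩                                ≡⟨ ⟨⟩-comm (residual a z) u ⟩
    ⟨ u , residual a z ⟩                                ≡⟨ ⟨,residual⟩ u a z ⟩
    ⟨ z , z ⟩ * ⟨ u , a ⟩ - ⟨ z , a ⟩ * ⟨ u , z ⟩
      ≡⟨ cong₂ (λ s t → ⟨ z , z ⟩ * s - ⟨ z , a ⟩ * t) (trans (⟨⟩-comm u a) a⊥u) (trans (⟨⟩-comm u z) z⊥u) ⟩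
    ⟨ z , z ⟩ * 0ℚ - ⟨ z , a ⟩ * 0ℚ
      ≡⟨ solve 2 (λ Z P → Z :* con 0ℚ :- P :* con 0ℚ := con 0ℚ) refl ⟨ z , z ⟩ ⟨ z , a ⟩ ⟩
    0ℚ                                                  ∎
    where open ≡-Reasoning

  -- A nonzero value of the residual would make it, z and the d independent vectors of the span
  -- n C 2 + 1 independent vectors.
  annihilators-proportional : ∀ {S d} → ContainsIndependent (InSpanTri S) d → ℕ.suc d ≡ n C 2 →
    ∀ {a z} → Annihilates a S → Annihilates z S → ∀ e → z e ≢ 0ℚ →
    ∀ f → ⟨ z , z ⟩ * a f ≡ ⟨ z , a ⟩ * z f
  annihilators-proportional {d = d} (v , v∈span , indep) d+1≡nC2 {a} {z} a⊥S z⊥S e ze≢0 f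
    with residual a z f QP.≟ 0ℚ
  ... | yes rf≡0 = begin
    Z * a f                    ≡⟨ solve 4 (λ Z P x y → Z :* x := (Z :* x :+ ((:- P) :* y :+ con 0ℚ)) :+ P :* y)
                                          refl Z P (a f) (z f) ⟩
    residual a z f + P * z f   ≡⟨ cong (_+ P * z f) rf≡0 ⟩
    0ℚ + P * z f               ≡⟨ QP.+-identityˡ (P * z f) ⟩
    P * z f                    ∎
    where
    open ≡-Reasoning
    Z P : ℚ
    Z = ⟨ z , z ⟩
    P = ⟨ z , a ⟩
  ... | no rf≢0 =
    ⊥-elim (NP.<-irrefl refl (subst (ℕ.suc (ℕ.suc d) ℕ.≤_) (sym d+1≡nC2)
                                     (LinIndep⇒≤nC2 (residual a z ∷ z ∷ v) indep-rzv)))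
    where
    z⊥v : ∀ k → ⟨ z , v k ⟩ ≡ 0ℚ
    z⊥v k = annihilates⇒⊥-span z⊥S (v∈span k)
    a⊥v : ∀ k → ⟨ a , v k ⟩ ≡ 0ℚ
    a⊥v k = annihilates⇒⊥-span a⊥S (v∈span k)
    r⊥zv : ∀ k → ⟨ residual a z , (z ∷ v) k ⟩ ≡ 0ℚ
    r⊥zv zero = residual-⊥-z a z
    r⊥zv (suc k) = residual-⊥-common a z (a⊥v k) (z⊥v k)
    indep-rzv : LinIndep (residual a z ∷ z ∷ v)
    indep-rzv = LinIndep-∷ (residual a z) {z ∷ v} f rf≢0 r⊥zv (LinIndep-∷ z e ze≢0 z⊥v indep)

module _ {n : ℕ} (col : Fin n → Bool) where

  Monochromatic : Triple n → Set
  Monochromatic ((i , j , k) , _) = col i ≡ col j × col j ≡ col k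

  -- The colour vector sums to -1 - 1 + 2 = 0 over every non-monochromatic triangle.
  colourVector : EVec n
  colourVector ((i , j) , _) = if col i xor col j then - 1ℚ else 1ℚ + 1ℚ

  colourVector-bichromatic : ∀ {i j} (i<j : i F.< j) → col i ≢ col j → colourVector ((i , j) , i<j) ≡ - 1ℚ
  colourVector-bichromatic {i} {j} _ ci≢cj with col i | col j
  ... | true  | true  = ⊥-elim (ci≢cj refl)
  ... | true  | false = refl
  ... | false | true  = refl
  ... | false | false = ⊥-elim (ci≢cj refl)

  colourVector-monochromatic : ∀ {i j} (i<j : i F.< j) → col i ≡ col j → colourVector ((i , j) , i<j) ≡ 1ℚ + 1ℚ
  colourVector-monochromatic {i} {j} _ ci≡cj rewrite ci≡cj with col j
  ... | true  = refl
  ... | false = refl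

  colourVector-annihilates : Annihilates colourVector (¬_ ∘ Monochromatic)
  colourVector-annihilates ((i , j , k) , _) ¬mono with col i | col j | col k
  ... | true  | true  | true  = ⊥-elim (¬mono (refl , refl))
  ... | true  | true  | false = refl
  ... | true  | false | true  = refl
  ... | true  | false | false = refl
  ... | false | true  | true  = refl
  ... | false | true  | false = refl
  ... | false | false | true  = refl
  ... | false | false | false = ⊥-elim (¬mono (refl , refl))

  module _ {y : EVec n} (bip : ∀ e → GEdge y e → col (proj₁ (proj₁ e)) ≢ col (proj₂ (proj₁ e))) where

    monochromatic⇒positive : ∀ {i j} (i<j : i F.< j) → col i ≡ col j → 0ℚ < y ((i , j) , i<j)
    monochromatic⇒positive i<j ci≡cj = QP.≰⇒> λ y≤0 → bip _ y≤0 ci≡cj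

    tight⇒¬monochromatic : ∀ K → Tight y K → ¬ Monochromatic K
    tight⇒¬monochromatic ((i , j , k) , i<j , j<k) tight (ci≡cj , cj≡ck) = QP.<⇒≢ y[K]>0 (sym tight)
      where
      y[K]>0 = QP.+-mono-< (QP.+-mono-< (monochromatic⇒positive i<j ci≡cj)
                                        (monochromatic⇒positive (FP.<-trans i<j j<k) (trans ci≡cj cj≡ck)))
                           (monochromatic⇒positive j<k cj≡ck)

    -- As Z y = P z and 2 z(e) + z(e′) = 0, the number Z (2 y(e) + y(e′)) vanishes; it would be positive if y(e) > 0.
    bichromatic⇒edge : IsFacetNormal n y → ∀ {i′ j′} (i′<j′ : i′ F.< j′) → col i′ ≡ col j′ →
      ∀ {i j} (i<j : i F.< j) → col i ≢ col j → GEdge y ((i , j) , i<j)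
    bichromatic⇒edge (_ , d , (independents , _) , d+1≡nC2) i′<j′ ci′≡cj′ i<j ci≢cj
      with y ((_ , _) , i<j) QP.≤? 0ℚ
    ... | yes ye≤0 = ye≤0
    ... | no ye≰0 = ⊥-elim (QP.<⇒≢ (*-pos Z>0 y-sum>0) (sym Z·y-sum≡0))
      where
      e = ((_ , _) , i<j)
      e′ = ((_ , _) , i′<j′)
      z = colourVector
      Z = ⟨ z , z ⟩
      P = ⟨ z , y ⟩
      ze≢0 : z e ≢ 0ℚ
      ze≢0 ze≡0 with () ← trans (sym (colourVector-bichromatic i<j ci≢cj)) ze≡0
      Z>0 : 0ℚ < Z
      Z>0 = ⟨⟩-pos z e ze≢0
      y-sum>0 : 0ℚ < y e + y e + y e′
      y-sum>0 = QP.+-mono-< (QP.+-mono-< (QP.≰⇒> ye≰0) (QP.≰⇒> ye≰0)) (monochromatic⇒positive i′<j′ ci′≡cj′)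
      proportional : ∀ f → Z * y f ≡ P * z f
      proportional = annihilators-proportional independents d+1≡nC2 (λ _ tight → tight)
                       (λ K tight → colourVector-annihilates K (tight⇒¬monochromatic K tight)) e ze≢0
      Z·y-sum≡0 : Z * (y e + y e + y e′) ≡ 0ℚ
      Z·y-sum≡0 = begin
        Z * (y e + y e + y e′)
          ≡⟨ solve 4 (λ Z a b c → Z :* (a :+ b :+ c) := Z :* a :+ Z :* b :+ Z :* c) refl Z (y e) (y e) (y e′) ⟩
        Z * y e + Z * y e + Z * y e′
          ≡⟨ cong₂ _+_ (cong₂ _+_ (proportional e) (proportional e)) (proportional e′) ⟩
        P * z e + P * z e + P * z e′
          ≡⟨ cong₂ (λ s t → P * s + P * s + P * t) (colourVector-bichromatic i<j ci≢cj)
                                                   (colourVector-monochromatic i′<j′ ci′≡cj′) ⟩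
        P * - 1ℚ + P * - 1ℚ + P * (1ℚ + 1ℚ)
          ≡⟨ solve 1 (λ P → P :* (:- con 1ℚ) :+ P :* (:- con 1ℚ) :+ P :* (con 1ℚ :+ con 1ℚ) := con 0ℚ) refl P ⟩
        0ℚ ∎
        where open ≡-Reasoning

monochromaticEdge : ∀ {n} (col : Fin (3 ℕ.+ n) → Bool) →
  Σ (Edge (3 ℕ.+ n)) λ e → col (proj₁ (proj₁ e)) ≡ col (proj₂ (proj₁ e))
monochromaticEdge col with col zero in c₀ | col (suc zero) in c₁ | col (suc (suc zero)) in c₂
... | true  | true  | _     = ((zero , suc zero) , s≤s z≤n) , trans c₀ (sym c₁)
... | false | false | _     = ((zero , suc zero) , s≤s z≤n) , trans c₀ (sym c₁)
... | true  | false | true  = ((zero , suc (suc zero)) , s≤s z≤n) , trans c₀ (sym c₂)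
... | false | true  | false = ((zero , suc (suc zero)) , s≤s z≤n) , trans c₀ (sym c₂)
... | true  | false | false = ((suc zero , suc (suc zero)) , s≤s (s≤s z≤n)) , trans c₁ (sym c₂)
... | false | true  | true  = ((suc zero , suc (suc zero)) , s≤s (s≤s z≤n)) , trans c₁ (sym c₂)

edgeless⇒completeBipartite : ∀ {n} {E : Edge n → Set} → (∀ e → ¬ E e) → IsCompleteBipartite E
edgeless⇒completeBipartite ¬E = (λ _ → true) , λ e → mk⇔ (⊥-elim ∘ ¬E e) (λ true≢true → ⊥-elim (true≢true refl))

onlyEdge₂ : ∀ (e : Edge 2) → e ≡ ((zero , suc zero) , s≤s z≤n)
onlyEdge₂ ((zero , suc zero) , 0<1) = edge-irrelevant 0<1 (s≤s z≤n)
onlyEdge₂ ((suc zero , suc zero) , s≤s ())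

proposition3p2 : (n : ℕ) (y : EVec n) → IsFacetNormal n y →
    IsBipartite (GEdge y) → IsCompleteBipartite (GEdge y)
proposition3p2 0 y _ _ = edgeless⇒completeBipartite λ { ((() , _) , _) }
proposition3p2 1 y _ _ = edgeless⇒completeBipartite λ { ((zero , zero) , ()) }
proposition3p2 2 y _ (col , bip) with y ((zero , suc zero) , s≤s z≤n) QP.≤? 0ℚ
... | yes y₀₁≤0 = col , λ e → mk⇔ (bip e) λ _ → subst (GEdge y) (sym (onlyEdge₂ e)) y₀₁≤0
... | no y₀₁≰0 = edgeless⇒completeBipartite λ e → y₀₁≰0 ∘ subst (GEdge y) (onlyEdge₂ e)
proposition3p2 (ℕ.suc (ℕ.suc (ℕ.suc n))) y facet (col , bip) =
  let (_ , i′<j′) , mono = monochromaticEdge col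
  in col , λ { e@(_ , i<j) → mk⇔ (bip e) (bichromatic⇒edge col bip facet i′<j′ mono i<j) }
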